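{- Let $R$ be a commutative ring, $V$ a free $R$-module of rank $n$, $G=\mathrm{Aut}_R(V)$, and $\tau\in\mathrm{End}_R(V)$. If $\tau$ admits a cyclic basis, then the centralizer $G_\tau$ acts simply transitively (via $g\cdot(e_1,\dots,e_n)=(ge_1,\dots,ge_n)$) on the set of all ordered bases of $V$ with respect to which $\tau$ is cyclic.
   Context: An ordered basis $(e_1,\dots,e_n)$ of $V$ is a cyclic basis for $\tau$ (and $\tau$ is cyclic with respect to it) if $\tau e_j=e_{j+1}$ for $j=1,\dots,n-1$. $G_\tau$ denotes the centralizer of $\tau$ in $G$. -}

module Defs where

open import Level using (_⊔_)
open import Data.Nat using (ℕ; suc)
open import Data.Fin using (Fin; toℕ)
import Data.Fin
import Relation.Nullary
open import Data.Product using (Σ; ∃; _×_)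
open import Relation.Binary.PropositionalEquality using (_≡_)
open import Algebra.Bundles using (CommutativeRing)
import Algebra.Definitions.RawMonoid as RM

-- Linear algebra on the free module V = R^n (coordinates w.r.t. a fixed basis);
-- R-endomorphisms of V are n×n matrices acting on column vectors.
module Lin {c ℓ} (R : CommutativeRing c ℓ) (n : ℕ) where
  open CommutativeRing R

  Vect : Set c
  Vect = Fin n → Carrier

  Mat : Set c
  Mat = Fin n → Fin n → Carrier

  Family : Set c
  Family = Fin n → Vect

  Σ[_] : (Fin n → Carrier) → Carrier
  Σ[ f ] = RM.sum +-rawMonoid f

  _≈ᵛ_ : Vect → Vect → Set ℓ
  u ≈ᵛ v = ∀ i → u i ≈ v i

  _≈ᴹ_ : Mat → Mat → Set ℓ
  M ≈ᴹ N = ∀ i j → M i j ≈ N i j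

  _≈ᶠ_ : Family → Family → Set ℓ
  e ≈ᶠ e' = ∀ j → e j ≈ᵛ e' j

  apply : Mat → Vect → Vect
  apply M v i = Σ[ (λ j → M i j * v j) ]

  _∘ᴹ_ : Mat → Mat → Mat
  (M ∘ᴹ N) i k = Σ[ (λ j → M i j * N j k) ]

  idᴹ : Mat
  idᴹ i j with i Data.Fin.≟ j
  ... | Relation.Nullary.yes _ = 1#
  ... | Relation.Nullary.no _ = 0#

  lincomb : Vect → Family → Vect
  lincomb coef e i = Σ[ (λ j → coef j * e j i) ]

  IsBasis : Family → Set (c ⊔ ℓ)
  IsBasis e = ∀ v → (∃ λ coef → lincomb coef e ≈ᵛ v)
                  × (∀ a b → lincomb a e ≈ᵛ v → lincomb b e ≈ᵛ v → a ≈ᵛ b)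

  IsCyclicBasis : Mat → Family → Set (c ⊔ ℓ)
  IsCyclicBasis τ e = IsBasis e
    × (∀ (i j : Fin n) → toℕ j ≡ suc (toℕ i) → apply τ (e i) ≈ᵛ e j)

  IsAut : Mat → Set (c ⊔ ℓ)
  IsAut g = ∃ λ h → ((g ∘ᴹ h) ≈ᴹ idᴹ) × ((h ∘ᴹ g) ≈ᴹ idᴹ)

  InCentralizer : Mat → Mat → Set (c ⊔ ℓ)
  InCentralizer τ g = IsAut g × ((g ∘ᴹ τ) ≈ᴹ (τ ∘ᴹ g))

  act : Mat → Family → Family
  act g e j = apply g (e j)

-- The centralizer of a cyclic τ consists of the polynomials in τ. If e and e' are
-- cyclic bases, write e'₁ = Σ dⱼ τ^(j-1) e₁ and put g = Σ dⱼ τ^(j-1): g commutes with τ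
-- and sends e₁ to e'₁, hence e_j = τ^(j-1) e₁ to e'_j. Exchanging the roles of e and e'
-- gives an h with h g and g h the identity on a basis, so g is invertible; and any map
-- is determined by its values on a basis, which gives uniqueness. Conversely an
-- invertible g commuting with τ maps bases to bases and preserves τ e_j = e_{j+1}.
module Submission where

open import Defs
open import Data.Product using (Σ; ∃; _×_; _,_; proj₁; proj₂)
open import Algebra.Bundles using (CommutativeRing)

open import Data.Nat as ℕ using (ℕ; zero; suc; _<_)
import Data.Nat.Properties as ℕ
open import Data.Fin as Fin using (Fin; toℕ; fromℕ<)
open import Data.Fin.Properties using (toℕ-injective; toℕ<n; toℕ-fromℕ<; suc-injective)
open import Data.Sum using (_⊎_; inj₁; inj₂)
open import Data.Empty using (⊥-elim)
open import Relation.Nullary using (¬_; yes; no)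
open import Relation.Binary.PropositionalEquality as ≡ using (_≡_; _≢_)
import Relation.Binary.Reasoning.Setoid as SetoidReasoning

Fin-empty-or-zero : ∀ n → ¬ Fin n ⊎ Σ (Fin n) (λ z → toℕ z ≡ 0)
Fin-empty-or-zero zero    = inj₁ λ ()
Fin-empty-or-zero (suc n) = inj₂ (Fin.zero , ≡.refl)

module _ {c ℓ} (R : CommutativeRing c ℓ) where
  open CommutativeRing R hiding (zero)
  open import Algebra.Properties.Semiring.Sum semiring
    using (sum; sum-cong-≋; ∑-comm; *-distribˡ-sum; sum-replicate-zero)
  open import Algebra.Properties.CommutativeSemigroup *-commutativeSemigroup
    using (x∙yz≈y∙xz)
  open import Data.Vec.Functional.Relation.Binary.Equality.Setoid setoid
    using (≋-refl; ≋-sym; ≋-trans; ≋-setoid)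

  sum-single : ∀ {n} (f : Fin n → Carrier) k → (∀ j → j ≢ k → f j ≈ 0#) → sum f ≈ f k
  sum-single {suc n} f Fin.zero vanish =
    trans (+-congˡ (trans (sum-cong-≋ {n} (λ j → vanish (Fin.suc j) λ ())) (sum-replicate-zero n)))
          (+-identityʳ _)
  sum-single f (Fin.suc k) vanish =
    trans (+-cong (vanish Fin.zero λ ()) (sum-single (λ j → f (Fin.suc j)) k
                    λ j j≢k → vanish (Fin.suc j) (λ eq → j≢k (suc-injective eq))))
          (+-identityˡ _)

  ∑-*-∑-comm : ∀ {m p} (x : Fin m → Carrier) (y : Fin p → Carrier) (F : Fin m → Fin p → Carrier) →
    sum (λ k → x k * sum (λ j → y j * F k j)) ≈ sum (λ j → y j * sum (λ k → x k * F k j))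
  ∑-*-∑-comm x y F = begin
    sum (λ k → x k * sum (λ j → y j * F k j))   ≈⟨ sum-cong-≋ (λ k → *-distribˡ-sum (x k) (λ j → y j * F k j)) ⟩
    sum (λ k → sum (λ j → x k * (y j * F k j))) ≈⟨ ∑-comm (λ k j → x k * (y j * F k j)) ⟩
    sum (λ j → sum (λ k → x k * (y j * F k j))) ≈⟨ sum-cong-≋ (λ j → sum-cong-≋ λ k → x∙yz≈y∙xz (x k) (y j) (F k j)) ⟩
    sum (λ j → sum (λ k → y j * (x k * F k j))) ≈⟨ sum-cong-≋ (λ j → *-distribˡ-sum (y j) (λ k → x k * F k j)) ⟨
    sum (λ j → y j * sum (λ k → x k * F k j))   ∎
    where open SetoidReasoning setoid

  ∑-∑-*-assoc : ∀ {m p} (y : Fin p → Carrier) (F : Fin p → Fin m → Carrier) (x : Fin m → Carrier) →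
    sum (λ k → sum (λ j → y j * F j k) * x k) ≈ sum (λ j → y j * sum (λ k → F j k * x k))
  ∑-∑-*-assoc y F x = begin
    sum (λ k → sum (λ j → y j * F j k) * x k) ≈⟨ sum-cong-≋ (λ k → *-comm (sum (λ j → y j * F j k)) (x k)) ⟩
    sum (λ k → x k * sum (λ j → y j * F j k)) ≈⟨ ∑-*-∑-comm x y (λ k j → F j k) ⟩
    sum (λ j → y j * sum (λ k → x k * F j k)) ≈⟨ sum-cong-≋ (λ j → *-congˡ {y j} (sum-cong-≋ λ k → *-comm (x k) (F j k))) ⟩
    sum (λ j → y j * sum (λ k → F j k * x k)) ∎
    where open SetoidReasoning setoid

  module _ (n : ℕ) where
    open Lin R n
    module ≈ᵛ-Reasoning = SetoidReasoning (≋-setoid n)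

    ≈ᴹ-refl : ∀ {M} → M ≈ᴹ M
    ≈ᴹ-refl _ _ = refl

    idᴹ-diagonal : ∀ k → idᴹ k k ≈ 1#
    idᴹ-diagonal k with k Fin.≟ k
    ... | yes _ = refl
    ... | no k≢k = ⊥-elim (k≢k ≡.refl)

    idᴹ-off-diagonal : ∀ {j k} → j ≢ k → idᴹ j k ≈ 0#
    idᴹ-off-diagonal {j} {k} j≢k with j Fin.≟ k
    ... | yes j≡k = ⊥-elim (j≢k j≡k)
    ... | no _ = refl

    apply-cong : ∀ {M N u v} → M ≈ᴹ N → u ≈ᵛ v → apply M u ≈ᵛ apply N v
    apply-cong M≈N u≈v i = sum-cong-≋ (λ j → *-cong (M≈N i j) (u≈v j))

    lincomb-cong : ∀ {a b e e'} → a ≈ᵛ b → e ≈ᶠ e' → lincomb a e ≈ᵛ lincomb b e'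
    lincomb-cong a≈b e≈e' i = sum-cong-≋ (λ j → *-cong (a≈b j) (e≈e' j i))

    apply-idᴹ : ∀ v → apply idᴹ v ≈ᵛ v
    apply-idᴹ v i =
      trans (sum-single _ i λ j j≢i → trans (*-congʳ (idᴹ-off-diagonal (λ j≡i → j≢i (≡.sym j≡i)))) (zeroˡ _))
            (trans (*-congʳ (idᴹ-diagonal i)) (*-identityˡ _))

    unitVect : Fin n → Vect
    unitVect k j = idᴹ j k

    apply-unitVect : ∀ M k → apply M (unitVect k) ≈ᵛ (λ i → M i k)
    apply-unitVect M k i =
      trans (sum-single _ k λ j j≢k → trans (*-congˡ (idᴹ-off-diagonal j≢k)) (zeroʳ _))
            (trans (*-congˡ (idᴹ-diagonal k)) (*-identityʳ _))

    apply-∘ᴹ : ∀ M N v → apply (M ∘ᴹ N) v ≈ᵛ apply M (apply N v)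
    apply-∘ᴹ M N v i = ∑-∑-*-assoc (M i) N v

    apply-lincomb : ∀ M a e → apply M (lincomb a e) ≈ᵛ lincomb a (act M e)
    apply-lincomb M a e i = ∑-*-∑-comm (M i) a (λ k j → e j k)

    apply-cancel : ∀ {h g} → (h ∘ᴹ g) ≈ᴹ idᴹ → ∀ v → apply h (apply g v) ≈ᵛ v
    apply-cancel {h} {g} hg≈id v =
      ≋-trans (≋-sym (apply-∘ᴹ h g v)) (≋-trans (apply-cong hg≈id ≋-refl) (apply-idᴹ v))

    apply-extensional : ∀ {M N} → (∀ v → apply M v ≈ᵛ apply N v) → M ≈ᴹ N
    apply-extensional {M} {N} M≗N i k =
      trans (sym (apply-unitVect M k i)) (trans (M≗N (unitVect k) i) (apply-unitVect N k i))

    agree-on-basis⇒≈ᴹ : ∀ {M N e} → IsBasis e → act M e ≈ᶠ act N e → M ≈ᴹ N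
    agree-on-basis⇒≈ᴹ {M} {N} {e} basis Me≈Ne = apply-extensional λ v →
      let (a , ae≈v) = proj₁ (basis v) in begin
        apply M v               ≈⟨ apply-cong ≈ᴹ-refl ae≈v ⟨
        apply M (lincomb a e)   ≈⟨ apply-lincomb M a e ⟩
        lincomb a (act M e)     ≈⟨ lincomb-cong ≋-refl Me≈Ne ⟩
        lincomb a (act N e)     ≈⟨ apply-lincomb N a e ⟨
        apply N (lincomb a e)   ≈⟨ apply-cong ≈ᴹ-refl ae≈v ⟩
        apply N v               ∎
      where open ≈ᵛ-Reasoning

    act-preserves-basis : ∀ {g e} → IsAut g → IsBasis e → IsBasis (act g e)
    act-preserves-basis {g} {e} (h , gh≈id , hg≈id) basis v = (a , ae≈v) , unique
      where
      open ≈ᵛ-Reasoning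
      a : Vect
      a = proj₁ (proj₁ (basis (apply h v)))
      ae≈v : lincomb a (act g e) ≈ᵛ v
      ae≈v = begin
        lincomb a (act g e)     ≈⟨ apply-lincomb g a e ⟨
        apply g (lincomb a e)   ≈⟨ apply-cong ≈ᴹ-refl (proj₂ (proj₁ (basis (apply h v)))) ⟩
        apply g (apply h v)     ≈⟨ apply-cancel gh≈id v ⟩
        v                       ∎
      pull-back : ∀ b → apply h (lincomb b (act g e)) ≈ᵛ lincomb b e
      pull-back b = ≋-trans (apply-lincomb h b (act g e))
                            (lincomb-cong ≋-refl λ j → apply-cancel hg≈id (e j))
      unique : ∀ b b' → lincomb b (act g e) ≈ᵛ v → lincomb b' (act g e) ≈ᵛ v → b ≈ᵛ b'
      unique b b' be≈v b'e≈v = proj₂ (basis (apply h v)) b b'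
        (≋-trans (≋-sym (pull-back b)) (apply-cong ≈ᴹ-refl be≈v))
        (≋-trans (≋-sym (pull-back b')) (apply-cong ≈ᴹ-refl b'e≈v))

    Commutes : Mat → Mat → Set ℓ
    Commutes g τ = (g ∘ᴹ τ) ≈ᴹ (τ ∘ᴹ g)

    apply-commutes : ∀ {g τ} → Commutes g τ → ∀ v → apply g (apply τ v) ≈ᵛ apply τ (apply g v)
    apply-commutes {g} {τ} gτ≈τg v =
      ≋-trans (≋-sym (apply-∘ᴹ g τ v)) (≋-trans (apply-cong gτ≈τg ≋-refl) (apply-∘ᴹ τ g v))

    commutes-from-apply : ∀ {g τ} → (∀ v → apply g (apply τ v) ≈ᵛ apply τ (apply g v)) → Commutes g τ
    commutes-from-apply {g} {τ} gτv≈τgv = apply-extensional λ v →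
      ≋-trans (apply-∘ᴹ g τ v) (≋-trans (gτv≈τgv v) (≋-sym (apply-∘ᴹ τ g v)))

    act-preserves-cyclicBasis : ∀ {τ g e} → InCentralizer τ g → IsCyclicBasis τ e → IsCyclicBasis τ (act g e)
    act-preserves-cyclicBasis {e = e} (aut , gτ≈τg) (basis , shift) =
      act-preserves-basis aut basis , λ i j j≡1+i →
        ≋-trans (≋-sym (apply-commutes gτ≈τg (e i))) (apply-cong ≈ᴹ-refl (shift i j j≡1+i))

    _^ᴹ_ : Mat → ℕ → Mat
    M ^ᴹ zero  = idᴹ
    M ^ᴹ suc k = M ∘ᴹ (M ^ᴹ k)

    ^ᴹ-commutes : ∀ {g τ} → Commutes g τ → ∀ k → Commutes g (τ ^ᴹ k)
    ^ᴹ-commutes {g} _ zero = commutes-from-apply λ v →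
      ≋-trans (apply-cong ≈ᴹ-refl (apply-idᴹ v)) (≋-sym (apply-idᴹ (apply g v)))
    ^ᴹ-commutes {g} {τ} gτ≈τg (suc k) = commutes-from-apply λ v → begin
      apply g (apply (τ ^ᴹ suc k) v)        ≈⟨ apply-cong ≈ᴹ-refl (apply-∘ᴹ τ (τ ^ᴹ k) v) ⟩
      apply g (apply τ (apply (τ ^ᴹ k) v))  ≈⟨ apply-commutes gτ≈τg (apply (τ ^ᴹ k) v) ⟩
      apply τ (apply g (apply (τ ^ᴹ k) v))  ≈⟨ apply-cong ≈ᴹ-refl (apply-commutes (^ᴹ-commutes gτ≈τg k) v) ⟩
      apply τ (apply (τ ^ᴹ k) (apply g v))  ≈⟨ apply-∘ᴹ τ (τ ^ᴹ k) (apply g v) ⟨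
      apply (τ ^ᴹ suc k) (apply g v)        ∎
      where open ≈ᵛ-Reasoning

    cyclicBasis-powers : ∀ {τ e} → IsCyclicBasis τ e →
      ∀ k i j → toℕ j ≡ k ℕ.+ toℕ i → e j ≈ᵛ apply (τ ^ᴹ k) (e i)
    cyclicBasis-powers {e = e} _ zero i j j≡i with toℕ-injective j≡i
    ... | ≡.refl = ≋-sym (apply-idᴹ (e i))
    cyclicBasis-powers {τ} {e} cyclic (suc k) i j j≡1+k+i = begin
      e j                             ≈⟨ proj₂ cyclic j' j (≡.trans j≡1+k+i (≡.cong suc (≡.sym (toℕ-fromℕ< k+i<n)))) ⟨
      apply τ (e j')                  ≈⟨ apply-cong ≈ᴹ-refl (cyclicBasis-powers cyclic k i j' (toℕ-fromℕ< k+i<n)) ⟩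
      apply τ (apply (τ ^ᴹ k) (e i))  ≈⟨ apply-∘ᴹ τ (τ ^ᴹ k) (e i) ⟨
      apply (τ ^ᴹ suc k) (e i)        ∎
      where
      open ≈ᵛ-Reasoning
      k+i<n : k ℕ.+ toℕ i < n
      k+i<n = ℕ.<-trans (ℕ.n<1+n (k ℕ.+ toℕ i)) (≡.subst (_< n) j≡1+k+i (toℕ<n j))
      j' : Fin n
      j' = fromℕ< k+i<n

    polynomial : Vect → Mat → Mat
    polynomial d τ i k = Σ[ (λ j → d j * (τ ^ᴹ toℕ j) i k) ]

    apply-polynomial : ∀ d τ v → apply (polynomial d τ) v ≈ᵛ lincomb d (λ j → apply (τ ^ᴹ toℕ j) v)
    apply-polynomial d τ v i = ∑-∑-*-assoc d (λ j k → (τ ^ᴹ toℕ j) i k) v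

    polynomial-commutes : ∀ d τ → Commutes (polynomial d τ) τ
    polynomial-commutes d τ = commutes-from-apply λ v → begin
      apply (polynomial d τ) (apply τ v)                ≈⟨ apply-polynomial d τ (apply τ v) ⟩
      lincomb d (λ j → apply (τ ^ᴹ toℕ j) (apply τ v))  ≈⟨ lincomb-cong ≋-refl (λ j →
                                                             apply-commutes (^ᴹ-commutes ≈ᴹ-refl (toℕ j)) v) ⟨
      lincomb d (λ j → apply τ (apply (τ ^ᴹ toℕ j) v))  ≈⟨ apply-lincomb τ d (λ j → apply (τ ^ᴹ toℕ j) v) ⟨
      apply τ (lincomb d (λ j → apply (τ ^ᴹ toℕ j) v))  ≈⟨ apply-cong ≈ᴹ-refl (apply-polynomial d τ v) ⟨
      apply τ (apply (polynomial d τ) v)                ∎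
      where open ≈ᵛ-Reasoning

    intertwiner-from : ∀ {τ e e'} (z : Fin n) → toℕ z ≡ 0 → IsCyclicBasis τ e → IsCyclicBasis τ e' →
      Σ Mat λ g → Commutes g τ × act g e ≈ᶠ e'
    intertwiner-from {τ} {e} {e'} z z≡0 cyclic cyclic' = g , polynomial-commutes d τ , ge≈e'
      where
      open ≈ᵛ-Reasoning
      d : Vect
      d = proj₁ (proj₁ (proj₁ cyclic (e' z)))
      g : Mat
      g = polynomial d τ
      powers-of-first : ∀ {f} → IsCyclicBasis τ f → ∀ j → f j ≈ᵛ apply (τ ^ᴹ toℕ j) (f z)
      powers-of-first cyclicᶠ j = cyclicBasis-powers cyclicᶠ (toℕ j) z j
        (≡.trans (≡.sym (ℕ.+-identityʳ (toℕ j))) (≡.cong (toℕ j ℕ.+_) (≡.sym z≡0)))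
      gez≈e'z : apply g (e z) ≈ᵛ e' z
      gez≈e'z = begin
        apply g (e z)                               ≈⟨ apply-polynomial d τ (e z) ⟩
        lincomb d (λ j → apply (τ ^ᴹ toℕ j) (e z))  ≈⟨ lincomb-cong ≋-refl (powers-of-first cyclic) ⟨
        lincomb d e                                 ≈⟨ proj₂ (proj₁ (proj₁ cyclic (e' z))) ⟩
        e' z                                        ∎
      ge≈e' : act g e ≈ᶠ e'
      ge≈e' j = begin
        apply g (e j)                       ≈⟨ apply-cong ≈ᴹ-refl (powers-of-first cyclic j) ⟩
        apply g (apply (τ ^ᴹ toℕ j) (e z))  ≈⟨ apply-commutes (^ᴹ-commutes (polynomial-commutes d τ) (toℕ j)) (e z) ⟩
        apply (τ ^ᴹ toℕ j) (apply g (e z))  ≈⟨ apply-cong ≈ᴹ-refl gez≈e'z ⟩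
        apply (τ ^ᴹ toℕ j) (e' z)           ≈⟨ powers-of-first cyclic' j ⟨
        e' j                                ∎

    intertwiner : ∀ {τ e e'} → IsCyclicBasis τ e → IsCyclicBasis τ e' →
      Σ Mat λ g → Commutes g τ × act g e ≈ᶠ e'
    intertwiner cyclic cyclic' with Fin-empty-or-zero n
    ... | inj₁ ¬Fin        = idᴹ , (λ i → ⊥-elim (¬Fin i)) , (λ j → ⊥-elim (¬Fin j))
    ... | inj₂ (z , z≡0)   = intertwiner-from z z≡0 cyclic cyclic'

    intertwiners-inverse : ∀ {g h e e'} → IsBasis e → act g e ≈ᶠ e' → act h e' ≈ᶠ e → (h ∘ᴹ g) ≈ᴹ idᴹ
    intertwiners-inverse {g} {h} {e} {e'} basis ge≈e' he'≈e = agree-on-basis⇒≈ᴹ basis λ j → begin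
      apply (h ∘ᴹ g) (e j)     ≈⟨ apply-∘ᴹ h g (e j) ⟩
      apply h (apply g (e j))  ≈⟨ apply-cong ≈ᴹ-refl (ge≈e' j) ⟩
      apply h (e' j)           ≈⟨ he'≈e j ⟩
      e j                      ≈⟨ apply-idᴹ (e j) ⟨
      apply idᴹ (e j)          ∎
      where open ≈ᵛ-Reasoning

    centralizer-acts-simply-transitively : ∀ {τ e e'} → IsCyclicBasis τ e → IsCyclicBasis τ e' →
      Σ Mat λ g → InCentralizer τ g × act g e ≈ᶠ e'
        × (∀ g' → InCentralizer τ g' → act g' e ≈ᶠ e' → g' ≈ᴹ g)
    centralizer-acts-simply-transitively (basis , shift) (basis' , shift')
      with intertwiner (basis , shift) (basis' , shift') | intertwiner (basis' , shift') (basis , shift)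
    ... | g , gτ≈τg , ge≈e' | h , _ , he'≈e =
      g , ((h , intertwiners-inverse basis' he'≈e ge≈e' , intertwiners-inverse basis ge≈e' he'≈e) , gτ≈τg)
        , ge≈e'
        , λ g' _ g'e≈e' → agree-on-basis⇒≈ᴹ basis λ j → ≋-trans (g'e≈e' j) (≋-sym (ge≈e' j))

lemma3p6 : ∀ {c ℓ} (R : CommutativeRing c ℓ) (n : ℕ) (τ : Lin.Mat R n) →
    (∃ λ e → Lin.IsCyclicBasis R n τ e) →
    (∀ g e → Lin.InCentralizer R n τ g → Lin.IsCyclicBasis R n τ e →
      Lin.IsCyclicBasis R n τ (Lin.act R n g e))
    ×
    (∀ e e' → Lin.IsCyclicBasis R n τ e → Lin.IsCyclicBasis R n τ e' →
      Σ (Lin.Mat R n) λ g → Lin.InCentralizer R n τ g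
        × Lin._≈ᶠ_ R n (Lin.act R n g e) e'
        × (∀ g' → Lin.InCentralizer R n τ g' →
             Lin._≈ᶠ_ R n (Lin.act R n g' e) e' → Lin._≈ᴹ_ R n g' g))
-- The existence of a cyclic basis only makes the set of cyclic bases nonempty.
lemma3p6 R n τ _ =
  (λ g e → act-preserves-cyclicBasis R n) , (λ e e' → centralizer-acts-simply-transitively R n)
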